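{- Let $n\ge 1$ and $i_0,i_1,\dots,i_n\in\{2,\dots,N\}$ with $i_j\neq i_{j+1}$ for $0\le j<n$. Let $L_0\in\{x_{1,N}+x_{i_0,N}+x_{i_1,N},\ x_{1,N}+x_{i_0,N}-x_{i_1,N}\}$; $L_j\in\{x_{1,N}+x_{i_j,N}+x_{i_{j+1},N},\ x_{1,N}+x_{i_j,N}-x_{i_{j+1},N},\ x_{1,N}-x_{i_j,N}+x_{i_{j+1},N}\}$ for $1\le j\le n-2$; $L_{n-1}\in\{x_{1,N}+x_{i_{n-1},N}+x_{i_n,N},\ x_{1,N}-x_{i_{n-1},N}+x_{i_n,N}\}$. Suppose that for $0\le j<n-1$, $L_j=x_{1,N}+x_{i_j,N}-x_{i_{j+1},N}$ if and only if $L_{j+1}=x_{1,N}-x_{i_{j+1},N}+x_{i_{j+2},N}$. Then there exist constants $c_j\in\{ -1,1\}$, $0\le j<n$, such that $$\sum_{j=0}^{n-1}c_jL_j=\begin{cases}x_{1,N}+x_{i_0,N}+x_{i_n,N}, & n\text{ odd},\\ x_{i_0,N}-x_{i_n,N}, & n\text{ even}.\end{cases}$$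
   Context: $x_{i,N}$ denotes the $i$th standard basis vector of $\mathbb{C}^N$. -}

module Defs where

open import Data.Nat using (ℕ; zero; suc; _≡ᵇ_)
open import Data.Fin using (Fin; toℕ)
open import Data.Integer using (ℤ; _+_; _-_; _*_; 0ℤ; 1ℤ)
open import Data.Bool using (if_then_else_)
open import Relation.Binary.PropositionalEquality using (_≡_)

-- Vectors with integer coordinates in dimension N (integer points of ℂ^N).
Vec : ℕ → Set
Vec N = Fin N → ℤ

-- x k N : the k-th standard basis vector, 1-based (coordinate m : Fin N is index toℕ m + 1).
x : ℕ → (N : ℕ) → Vec N
x k N m = if (suc (toℕ m) ≡ᵇ k) then 1ℤ else 0ℤ

infixl 6 _⊕_ _⊖_
_⊕_ : ∀ {N} → Vec N → Vec N → Vec N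
(u ⊕ v) m = u m + v m

_⊖_ : ∀ {N} → Vec N → Vec N → Vec N
(u ⊖ v) m = u m - v m

_·_ : ∀ {N} → ℤ → Vec N → Vec N
(c · v) m = c * v m

infix 4 _≐_
_≐_ : ∀ {N} → Vec N → Vec N → Set
u ≐ v = ∀ m → u m ≡ v m

sumV : ∀ {N} → (ℕ → Vec N) → ℕ → Vec N
sumV f zero m = 0ℤ
sumV f (suc n) m = sumV f n m + f n m

-- Put a = x_1, r_0 = x_{i_0} and r_{j+1} = L_j - a - r_j, so that L_j = a + r_j + r_{j+1}.
-- With c_j = (-1)^j the sum telescopes to (1 - 1 + 1 - ⋯) a + r_0 - (-1)^n r_n.
-- Inductively r_{j+1} = -x_{i_{j+1}} if L_j = x_1 + x_{i_j} - x_{i_{j+1}} and r_{j+1} = x_{i_{j+1}}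
-- otherwise: the matching condition makes L_{j+1} start with -x_{i_{j+1}} exactly when the
-- sign has to be restored.  As L_{n-1} ends in +x_{i_n}, r_n = x_{i_n}.
module Submission where

open import Defs
open import Data.Nat using (ℕ; suc; _≤_; _<_; _∸_; _%_)
open import Data.Integer using (ℤ; -_; 1ℤ)
open import Data.Product using (_×_; ∃)
open import Data.Sum using (_⊎_)
open import Relation.Nullary using (¬_)
open import Relation.Binary.PropositionalEquality using (_≡_)
open import Function.Bundles using (_⇔_)

open import Data.Nat using (zero; s≤s; z≤n; _≡ᵇ_)
open import Data.Nat.Properties using (≡ᵇ⇒≡; ≡⇒≡ᵇ; ≤-refl; ≤-trans; n≤1+n; m≤n⇒m<n∨m≡n; ∸-monoˡ-≤; 0≢1+n)
open import Data.Integer using (_+_; _-_; _*_; _^_; 0ℤ; -1ℤ; +_)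
open import Data.Integer.Properties using (i≡j⇒i-j≡0)
open import Data.Integer.Tactic.RingSolver using (solve-∀)
open import Data.Fin using (Fin; toℕ; fromℕ<)
open import Data.Fin.Properties using (toℕ-fromℕ<)
open import Data.Bool using (true; false)
open import Data.Product using (_,_; Σ; proj₁; proj₂)
open import Data.Sum using (inj₁; inj₂; [_,_]′)
open import Data.Empty using (⊥-elim)
open import Relation.Binary.PropositionalEquality using (refl; sym; trans; cong; subst; _≢_; module ≡-Reasoning)
open Function.Bundles.Equivalence using (to; from)

x-diagonal : ∀ {N} (m : Fin N) → x (suc (toℕ m)) N m ≡ 1ℤ
x-diagonal m with suc (toℕ m) ≡ᵇ suc (toℕ m) | ≡⇒≡ᵇ (suc (toℕ m)) (suc (toℕ m)) refl
... | true | _ = refl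

x-off-diagonal : ∀ {N} (m : Fin N) {k} → suc (toℕ m) ≢ k → x k N m ≡ 0ℤ
x-off-diagonal m {k} ne with suc (toℕ m) ≡ᵇ k | ≡ᵇ⇒≡ (suc (toℕ m)) k
... | true | eq = ⊥-elim (ne (eq _))
... | false | _ = refl

x-support : ∀ {N q} → 1 ≤ q → q ≤ N →
  Σ (Fin N) λ m → x q N m ≡ 1ℤ × (∀ {p} → p ≢ q → x p N m ≡ 0ℤ)
x-support {q = suc q} _ q<N = m , subst (λ k → x k _ m ≡ 1ℤ) index (x-diagonal m)
                                 , λ p≢q → x-off-diagonal m (λ eq → p≢q (trans (sym eq) index))
  where
  m = fromℕ< q<N
  index : suc (toℕ m) ≡ suc q
  index = cong suc (toℕ-fromℕ< q<N)

plus-one≢minus-one : ∀ z → z + 1ℤ ≢ z - 1ℤ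
plus-one≢minus-one z eq = two≢zero (trans (sym (difference z)) (i≡j⇒i-j≡0 eq))
  where
  difference : ∀ z → (z + 1ℤ) - (z - 1ℤ) ≡ + 2
  difference = solve-∀
  two≢zero : + 2 ≢ 0ℤ
  two≢zero ()

module _ {N : ℕ} (a : Vec N) {q : ℕ} (1≤q : 1 ≤ q) (q≤N : q ≤ N) where

  ⁺⁺≉⁺⁻ : (u : Vec N) → ¬ (a ⊕ u ⊕ x q N ≐ a ⊕ u ⊖ x q N)
  ⁺⁺≉⁺⁻ u eq with x-support 1≤q q≤N
  ... | m , xq[m]≡1 , _ = plus-one≢minus-one (a m + u m) (evaluate (eq m))
    where
    evaluate : a m + u m + x q N m ≡ a m + u m - x q N m → a m + u m + 1ℤ ≡ a m + u m - 1ℤ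
    evaluate rewrite xq[m]≡1 = λ e → e

  ⁻⁺≉⁺⁻ : ∀ {p} → p ≢ q → ¬ (a ⊖ x p N ⊕ x q N ≐ a ⊕ x p N ⊖ x q N)
  ⁻⁺≉⁺⁻ {p} p≢q eq with x-support 1≤q q≤N
  ... | m , xq[m]≡1 , xp[m]≡0 = plus-one≢minus-one (a m + 0ℤ) (evaluate (eq m))
    where
    evaluate : a m - x p N m + x q N m ≡ a m + x p N m - x q N m → a m + 0ℤ + 1ℤ ≡ a m + 0ℤ - 1ℤ
    evaluate rewrite xq[m]≡1 | xp[m]≡0 p≢q = λ e → e

alternatingSum : ℕ → ℤ
alternatingSum zero = 0ℤ
alternatingSum (suc n) = alternatingSum n + -1ℤ ^ n

parity-cases : ∀ n → (n % 2 ≡ 0 × -1ℤ ^ n ≡ 1ℤ × alternatingSum n ≡ 0ℤ)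
                   ⊎ (n % 2 ≡ 1 × -1ℤ ^ n ≡ -1ℤ × alternatingSum n ≡ 1ℤ)
parity-cases zero = inj₁ (refl , refl , refl)
parity-cases (suc zero) = inj₂ (refl , refl , refl)
parity-cases (suc (suc n)) with parity-cases n
... | inj₁ (n%2≡0 , sign≡1 , sum≡0) rewrite sign≡1 | sum≡0 = inj₁ (n%2≡0 , refl , refl)
... | inj₂ (n%2≡1 , sign≡-1 , sum≡1) rewrite sign≡-1 | sum≡1 = inj₂ (n%2≡1 , refl , refl)

sign-values : ∀ j → (-1ℤ ^ j ≡ 1ℤ) ⊎ (-1ℤ ^ j ≡ -1ℤ)
sign-values j = [ (λ (_ , e , _) → inj₁ e) , (λ (_ , e , _) → inj₂ e) ]′ (parity-cases j)

module Telescope {N : ℕ} (a r₀ : Vec N) (L : ℕ → Vec N) where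

  residual : ℕ → Vec N
  residual zero = r₀
  residual (suc j) = L j ⊖ a ⊖ residual j

  sumV-alternating : ∀ n →
    sumV (λ j → (-1ℤ ^ j) · L j) n ≐ alternatingSum n · a ⊕ r₀ ⊖ (-1ℤ ^ n) · residual n
  sumV-alternating zero m = base (a m) (r₀ m)
    where
    base : ∀ α ρ → 0ℤ ≡ 0ℤ * α + ρ - 1ℤ * ρ
    base = solve-∀
  sumV-alternating (suc n) m = begin
    sumV (λ j → (-1ℤ ^ j) · L j) n m + -1ℤ ^ n * L n m
      ≡⟨ cong (_+ -1ℤ ^ n * L n m) (sumV-alternating n m) ⟩
    alternatingSum n * a m + r₀ m - -1ℤ ^ n * residual n m + -1ℤ ^ n * L n m
      ≡⟨ step (alternatingSum n) (-1ℤ ^ n) (a m) (r₀ m) (residual n m) (L n m) ⟩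
    (alternatingSum n + -1ℤ ^ n) * a m + r₀ m - (-1ℤ * -1ℤ ^ n) * (L n m - a m - residual n m) ∎
    where
    open ≡-Reasoning
    step : ∀ σ ε α ρ r ℓ → σ * α + ρ - ε * r + ε * ℓ ≡ (σ + ε) * α + ρ - (-1ℤ * ε) * (ℓ - α - r)
    step = solve-∀

  module _ (j : ℕ) {u v : Vec N} where

    residual-⁺⁺ : residual j ≐ u → L j ≐ a ⊕ u ⊕ v → residual (suc j) ≐ v
    residual-⁺⁺ r ℓ m rewrite ℓ m | r m = cancel (a m) (u m) (v m)
      where
      cancel : ∀ α μ ν → α + μ + ν - α - μ ≡ ν
      cancel = solve-∀

    residual-⁺⁻ : residual j ≐ u → L j ≐ a ⊕ u ⊖ v → residual (suc j) ≐ -1ℤ · v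
    residual-⁺⁻ r ℓ m rewrite ℓ m | r m = cancel (a m) (u m) (v m)
      where
      cancel : ∀ α μ ν → α + μ - ν - α - μ ≡ -1ℤ * ν
      cancel = solve-∀

    residual-⁻⁺ : residual j ≐ -1ℤ · u → L j ≐ a ⊖ u ⊕ v → residual (suc j) ≐ v
    residual-⁻⁺ r ℓ m rewrite ℓ m | r m = cancel (a m) (u m) (v m)
      where
      cancel : ∀ α μ ν → α - μ + ν - α - -1ℤ * μ ≡ ν
      cancel = solve-∀

module SignPropagation (N n' : ℕ) (i : ℕ → ℕ)
  (i-bounds : ∀ j → j ≤ suc n' → 2 ≤ i j × i j ≤ N)
  (i-step : ∀ j → j < suc n' → ¬ (i j ≡ i (suc j)))
  (L : ℕ → Vec N)
  (L-first : (L 0 ≐ x 1 N ⊕ x (i 0) N ⊕ x (i 1) N) ⊎ (L 0 ≐ x 1 N ⊕ x (i 0) N ⊖ x (i 1) N))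
  (L-middle : ∀ j → 1 ≤ j → j ≤ suc n' ∸ 2 →
      (L j ≐ x 1 N ⊕ x (i j) N ⊕ x (i (suc j)) N)
      ⊎ (L j ≐ x 1 N ⊕ x (i j) N ⊖ x (i (suc j)) N)
      ⊎ (L j ≐ x 1 N ⊖ x (i j) N ⊕ x (i (suc j)) N))
  (L-last : (L n' ≐ x 1 N ⊕ x (i n') N ⊕ x (i (suc n')) N)
      ⊎ (L n' ≐ x 1 N ⊖ x (i n') N ⊕ x (i (suc n')) N))
  (L-matching : ∀ j → suc j < suc n' →
      (L j ≐ x 1 N ⊕ x (i j) N ⊖ x (i (suc j)) N)
      ⇔ (L (suc j) ≐ x 1 N ⊖ x (i (suc j)) N ⊕ x (i (suc (suc j))) N))
  where

  n : ℕ
  n = suc n'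

  a : Vec N
  a = x 1 N

  b : ℕ → Vec N
  b j = x (i j) N

  P M Q : ℕ → Vec N
  P j = a ⊕ b j ⊕ b (suc j)
  M j = a ⊕ b j ⊖ b (suc j)
  Q j = a ⊖ b j ⊕ b (suc j)

  open Telescope a (b 0) L

  module _ (j : ℕ) (j<n : j < n) where

    private
      1≤i : 1 ≤ i (suc j)
      1≤i = ≤-trans (n≤1+n 1) (proj₁ (i-bounds (suc j) j<n))
      i≤N : i (suc j) ≤ N
      i≤N = proj₂ (i-bounds (suc j) j<n)

    P≉M : L j ≐ P j → ¬ L j ≐ M j
    P≉M p m = ⁺⁺≉⁺⁻ a 1≤i i≤N (b j) (λ c → trans (sym (p c)) (m c))

    Q≉M : L j ≐ Q j → ¬ L j ≐ M j
    Q≉M q m = ⁻⁺≉⁺⁻ a 1≤i i≤N (i-step j j<n) (λ c → trans (sym (q c)) (m c))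

  shape-suc : ∀ k → suc k ≤ n' →
    (L (suc k) ≐ P (suc k)) ⊎ (L (suc k) ≐ M (suc k)) ⊎ (L (suc k) ≐ Q (suc k))
  shape-suc k le with m≤n⇒m<n∨m≡n le
  ... | inj₁ lt = L-middle (suc k) (s≤s z≤n) (∸-monoˡ-≤ 1 lt)
  ... | inj₂ refl = [ inj₁ , (λ q → inj₂ (inj₂ q)) ]′ L-last

  SignedResidual : ℕ → Set
  SignedResidual k = (residual (suc k) ≐ b (suc k) × ((L k ≐ P k) ⊎ (L k ≐ Q k)))
                   ⊎ (residual (suc k) ≐ -1ℤ · b (suc k) × L k ≐ M k)

  signedResidual : ∀ k → k ≤ n' → SignedResidual k
  signedResidual zero _ = [ (λ p → inj₁ (residual-⁺⁺ 0 (λ _ → refl) p , inj₁ p))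
                          , (λ m → inj₂ (residual-⁺⁻ 0 (λ _ → refl) m , m)) ]′ L-first
  signedResidual (suc k) le with signedResidual k (≤-trans (n≤1+n k) le)
  ... | inj₂ (r , m) = let q = to (L-matching k (s≤s le)) m in inj₁ (residual-⁻⁺ (suc k) r q , inj₂ q)
  ... | inj₁ (r , pq) with shape-suc k le
  ...   | inj₁ p = inj₁ (residual-⁺⁺ (suc k) r p , inj₁ p)
  ...   | inj₂ (inj₁ m) = inj₂ (residual-⁺⁻ (suc k) r m , m)
  ...   | inj₂ (inj₂ q) = ⊥-elim ([ P≉M k k<n , Q≉M k k<n ]′ pq (from (L-matching k (s≤s le)) q))
    where k<n = s≤s (≤-trans (n≤1+n k) le)

  residual-last : residual n ≐ b n
  residual-last with signedResidual n' ≤-refl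
  ... | inj₁ (r , _) = r
  ... | inj₂ (_ , m) = ⊥-elim ([ (λ p → P≉M n' ≤-refl p m) , (λ q → Q≉M n' ≤-refl q m) ]′ L-last)

  alternating-sum : sumV (λ j → (-1ℤ ^ j) · L j) n ≐ alternatingSum n · a ⊕ b 0 ⊖ (-1ℤ ^ n) · b n
  alternating-sum m = trans (sumV-alternating n m)
                            (cong (λ r → alternatingSum n * a m + b 0 m - -1ℤ ^ n * r) (residual-last m))

  alternating-sum-odd : n % 2 ≡ 1 → sumV (λ j → (-1ℤ ^ j) · L j) n ≐ a ⊕ b 0 ⊕ b n
  alternating-sum-odd odd m with parity-cases n
  ... | inj₁ (even , _) = ⊥-elim (0≢1+n (trans (sym even) odd))
  ... | inj₂ (_ , sign≡-1 , sum≡1) rewrite alternating-sum m | sign≡-1 | sum≡1 =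
    simplify (a m) (b 0 m) (b n m)
    where
    simplify : ∀ α β₀ βₙ → 1ℤ * α + β₀ - -1ℤ * βₙ ≡ α + β₀ + βₙ
    simplify = solve-∀

  alternating-sum-even : n % 2 ≡ 0 → sumV (λ j → (-1ℤ ^ j) · L j) n ≐ b 0 ⊖ b n
  alternating-sum-even even m with parity-cases n
  ... | inj₂ (odd , _) = ⊥-elim (0≢1+n (trans (sym even) odd))
  ... | inj₁ (_ , sign≡1 , sum≡0) rewrite alternating-sum m | sign≡1 | sum≡0 =
    simplify (a m) (b 0 m) (b n m)
    where
    simplify : ∀ α β₀ βₙ → 0ℤ * α + β₀ - 1ℤ * βₙ ≡ β₀ - βₙ
    simplify = solve-∀

mainTheorem19 : (N n : ℕ) → 1 ≤ n →
    (i : ℕ → ℕ) →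
    (∀ j → j ≤ n → 2 ≤ i j × i j ≤ N) →
    (∀ j → j < n → ¬ (i j ≡ i (suc j))) →
    (L : ℕ → Vec N) →
    ((L 0 ≐ x 1 N ⊕ x (i 0) N ⊕ x (i 1) N) ⊎ (L 0 ≐ x 1 N ⊕ x (i 0) N ⊖ x (i 1) N)) →
    (∀ j → 1 ≤ j → j ≤ n ∸ 2 →
      (L j ≐ x 1 N ⊕ x (i j) N ⊕ x (i (suc j)) N)
      ⊎ (L j ≐ x 1 N ⊕ x (i j) N ⊖ x (i (suc j)) N)
      ⊎ (L j ≐ x 1 N ⊖ x (i j) N ⊕ x (i (suc j)) N)) →
    ((L (n ∸ 1) ≐ x 1 N ⊕ x (i (n ∸ 1)) N ⊕ x (i n) N)
      ⊎ (L (n ∸ 1) ≐ x 1 N ⊖ x (i (n ∸ 1)) N ⊕ x (i n) N)) →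
    (∀ j → suc j < n →
      (L j ≐ x 1 N ⊕ x (i j) N ⊖ x (i (suc j)) N)
      ⇔ (L (suc j) ≐ x 1 N ⊖ x (i (suc j)) N ⊕ x (i (suc (suc j))) N)) →
    ∃ λ (c : ℕ → ℤ) →
      (∀ j → j < n → (c j ≡ 1ℤ) ⊎ (c j ≡ - 1ℤ))
      × (n % 2 ≡ 1 → sumV (λ j → c j · L j) n ≐ x 1 N ⊕ x (i 0) N ⊕ x (i n) N)
      × (n % 2 ≡ 0 → sumV (λ j → c j · L j) n ≐ x (i 0) N ⊖ x (i n) N)
mainTheorem19 N (suc n') _ i i-bounds i-step L L-first L-middle L-last L-matching =
  (-1ℤ ^_) , (λ j _ → sign-values j) , alternating-sum-odd , alternating-sum-even
  where
  open SignPropagation N n' i i-bounds i-step L L-first L-middle L-last L-matching
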